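{- Let $p>1$ be an integer and let $u^{(p)}$ be the fixed point of the substitution $\varphi_p(L)=L^pS$, $\varphi_p(S)=M$, $\varphi_p(M)=L^{p-1}S$ starting with $L$. (i) For every factor $\hat v$ of $u^{(p)}$ it holds $|\hat v|_M\le 1+\frac{|\hat v|-1}{p^2+p}$. (ii) If moreover $\hat v$ has a prefix or a suffix of length at least $\Delta$ that contains no letter $M$, then $|\hat v|_M\le \left\lceil\frac{|\hat v|-\Delta}{p^2+p}\right\rceil$.
   Context: A factor is a finite contiguous block of $u^{(p)}$; $|w|$ is the length of $w$ and $|w|_M$ the number of occurrences of $M$ in $w$. -}

module Defs where

open import Data.Nat using (ℕ; zero; suc; _+_; _*_; _∸_; _^_; _/_)
open import Data.List using (List; []; _∷_; _++_; replicate; concatMap; length; take; drop; map; filter; reverse)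
open import Data.Nat.Base using (_≤_)
open import Relation.Binary.PropositionalEquality using (_≡_)
open import Relation.Nullary using (Dec; yes; no)

data Letter : Set where
  L S M : Letter

φ : ℕ → Letter → List Letter
φ p L = replicate p L ++ (S ∷ [])
φ p S = M ∷ []
φ p M = replicate (p ∸ 1) L ++ (S ∷ [])

φ* : ℕ → List Letter → List Letter
φ* p = concatMap (φ p)

iter : ℕ → ℕ → List Letter
iter p zero = L ∷ []
iter p (suc k) = φ* p (iter p k)

-- k-th letter of a word, with a default when out of range
at : List Letter → ℕ → Letter
at [] _ = L
at (x ∷ _) zero = x
at (_ ∷ xs) (suc n) = at xs n

-- The fixed point u^(p) starting with L, as an infinite word ℕ → Letter.
-- Since φ_p(L) begins with L and |φ_p^k(L)| ≥ k+1 (for p ≥ 1),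
-- the n-th letter of u^(p) equals the n-th letter of φ_p^(n+1)(L).
u : ℕ → ℕ → Letter
u p n = at (iter p (suc n)) n

factor : ℕ → ℕ → ℕ → List Letter
factor p i zero = []
factor p i (suc n) = u p i ∷ factor p (suc i) n

isM : (x : Letter) → Dec (x ≡ M)
isM L = no (λ ())
isM S = no (λ ())
isM M = yes _≡_.refl

countM : List Letter → ℕ
countM w = length (filter isM w)

⌈_/_⌉ : ℕ → ℕ → ℕ
⌈ a / zero ⌉ = 0
⌈ a / suc q ⌉ = (a + q) / suc q

-- The occurrences of M in u^(p) are at least p² + p apart. Indeed u^(p) = φ_p²(u^(p)) is a
-- concatenation of the blocks φ_p²(L) = (L^p S)^p M, φ_p²(S) = L^(p-1) S and
-- φ_p²(M) = (L^p S)^(p-1) M, each M of u^(p) ending a block φ_p²(L) or φ_p²(M); since in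
-- u^(p) every M follows an S, a block φ_p²(M) is preceded by a block φ_p²(S), which
-- supplies the p missing letters. Given this spacing, a window of length n contains at
-- most ⌈n / (p² + p)⌉ letters M, and after an M-free prefix or suffix of length Δ the
-- remaining n - Δ letters must contain them all.
module Submission where

open import Defs
open import Data.Nat using (ℕ; zero; suc; z≤n; s≤s; _+_; _*_; _∸_; _/_; _≤_; _<_)
open import Data.Nat.Properties
open import Data.Nat.DivMod using (m*n/n≡m; /-monoˡ-≤)
open import Data.Nat.Solver using (module +-*-Solver)
open import Data.List using (List; []; _∷_; _++_; replicate; take; drop; length)
open import Data.List.Properties using (++-assoc; ++-identityʳ; take++drop≡id; concatMap-++; length-++)
open import Data.Product using (_×_; ∃; _,_; proj₂)
open import Data.Sum using (_⊎_; inj₁; inj₂)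
open import Data.Unit using (⊤; tt)
open import Relation.Nullary using (yes; no)
open import Relation.Binary.PropositionalEquality using (_≡_; refl; sym; trans; cong; cong₂; subst)

countM-++ : ∀ v w → countM (v ++ w) ≡ countM v + countM w
countM-++ [] w = refl
countM-++ (L ∷ v) w = countM-++ v w
countM-++ (S ∷ v) w = countM-++ v w
countM-++ (M ∷ v) w = cong suc (countM-++ v w)

countM-take-drop : ∀ a w → countM w ≡ countM (take a w) + countM (drop a w)
countM-take-drop a w =
  trans (cong countM (sym (take++drop≡id a w))) (countM-++ (take a w) (drop a w))

at-++ : ∀ v w {n} → n < length v → at (v ++ w) n ≡ at v n
at-++ (x ∷ v) w {zero} _ = refl
at-++ (x ∷ v) w {suc n} (s≤s n<∣v∣) = at-++ v w n<∣v∣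

take-factor : ∀ p i {a n} → a ≤ n → take a (factor p i n) ≡ factor p i a
take-factor p i {zero} _ = refl
take-factor p i {suc a} (s≤s a≤n) = cong (u p i ∷_) (take-factor p (suc i) a≤n)

drop-factor : ∀ p i a n → drop a (factor p i n) ≡ factor p (i + a) (n ∸ a)
drop-factor p i zero n = cong (λ j → factor p j n) (sym (+-identityʳ i))
drop-factor p i (suc a) zero = refl
drop-factor p i (suc a) (suc n) =
  trans (drop-factor p (suc i) a n) (cong (λ j → factor p j (n ∸ a)) (sym (+-suc i a)))

module Iterates (k : ℕ) where

  p : ℕ
  p = suc k

  iter-head : ∀ m → ∃ λ w → iter p m ≡ L ∷ w
  iter-head zero = [] , refl
  iter-head (suc m) rewrite proj₂ (iter-head m) = _ , refl

  iter-prefix : ∀ {m n} → m ≤ n → ∃ λ t → iter p n ≡ iter p m ++ t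
  iter-prefix {zero} {n} _ = iter-head n
  iter-prefix {suc m} (s≤s m≤n) with iter-prefix m≤n
  ... | t , eq = φ* p t , trans (cong (φ* p) eq) (concatMap-++ (φ p) (iter p m) t)

  φ-nonempty : ∀ x → 1 ≤ length (φ p x)
  φ-nonempty L = s≤s z≤n
  φ-nonempty S = s≤s z≤n
  φ-nonempty M = ≤-trans (m≤n+m 1 _) (≤-reflexive (sym (length-++ (replicate k L))))

  length-φ* : ∀ w → length w ≤ length (φ* p w)
  length-φ* [] = z≤n
  length-φ* (x ∷ w) = ≤-trans (+-mono-≤ (φ-nonempty x) (length-φ* w))
                        (≤-reflexive (sym (length-++ (φ p x))))

  -- φ_p(L) = L φ_p(M), so the image of L ∷ w is longer than L ∷ w.
  length-iter : ∀ m → m < length (iter p m)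
  length-iter zero = s≤s z≤n
  length-iter (suc m) with iter-head m | length-iter m
  ... | w , eq | m<∣iter∣ rewrite eq = s≤s (≤-trans m<∣iter∣ (length-φ* (M ∷ w)))

  u-at-iter : ∀ {a m} → a < m → u p a ≡ at (iter p m) a
  u-at-iter {a} a<m with iter-prefix a<m
  ... | t , eq = sym (trans (cong (λ w → at w a) eq)
                   (at-++ (iter p (suc a)) t (<-trans (n<1+n a) (length-iter (suc a)))))

-- Spaced q d w: each M of w is at distance at least q from the previous M, an M being
-- assumed d + 1 positions before the start of w.
Spaced : ℕ → ℕ → List Letter → Set
Spaced q d [] = ⊤
Spaced q d (L ∷ w) = Spaced q (suc d) w
Spaced q d (S ∷ w) = Spaced q (suc d) w
Spaced q d (M ∷ w) = q ≤ suc d × Spaced q 0 w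

SpacedBy : ℕ → (ℕ → Letter) → Set
SpacedBy q f = ∀ {a b} → f a ≡ M → f b ≡ M → a < b → a + q ≤ b

module _ {q : ℕ} where

  Spaced-replicateL : ∀ j {d} r → Spaced q (j + d) r → Spaced q d (replicate j L ++ r)
  Spaced-replicateL zero r sp = sp
  Spaced-replicateL (suc j) {d} r sp =
    Spaced-replicateL j r (subst (λ e → Spaced q e r) (sym (+-suc j d)) sp)

  Spaced-tail : ∀ x w {d} → Spaced q d (x ∷ w) → ∃ λ d′ → Spaced q d′ w
  Spaced-tail L w sp = _ , sp
  Spaced-tail S w sp = _ , sp
  Spaced-tail M w sp = _ , proj₂ sp

  Spaced-at-M : ∀ w {d} b → Spaced q d w → at w b ≡ M → q ≤ suc (d + b)
  Spaced-at-M [] b _ ()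
  Spaced-at-M (L ∷ w) zero _ ()
  Spaced-at-M (S ∷ w) zero _ ()
  Spaced-at-M (M ∷ w) {d} zero (q≤1+d , _) refl =
    subst (λ e → q ≤ suc e) (sym (+-identityʳ d)) q≤1+d
  Spaced-at-M (L ∷ w) {d} (suc b) sp eq =
    subst (λ e → q ≤ suc e) (sym (+-suc d b)) (Spaced-at-M w b sp eq)
  Spaced-at-M (S ∷ w) {d} (suc b) sp eq =
    subst (λ e → q ≤ suc e) (sym (+-suc d b)) (Spaced-at-M w b sp eq)
  Spaced-at-M (M ∷ w) {d} (suc b) (_ , sp) eq =
    ≤-trans (Spaced-at-M w b sp eq) (s≤s (≤-trans (n≤1+n b) (m≤n+m (suc b) d)))

  Spaced-gap : ∀ w {d} a b → Spaced q d w → at w a ≡ M → at w b ≡ M → a < b → a + q ≤ b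
  Spaced-gap (M ∷ w) zero (suc b) (_ , sp) _ eq _ = Spaced-at-M w b sp eq
  Spaced-gap (L ∷ w) zero b _ () _ _
  Spaced-gap (S ∷ w) zero b _ () _ _
  Spaced-gap (x ∷ w) (suc a) (suc b) sp eqa eqb (s≤s a<b) with Spaced-tail x w sp
  ... | _ , sp′ = s≤s (Spaced-gap w a b sp′ eqa eqb a<b)

-- Admissible y w: in the word y ∷ w every S follows an L and every M follows an S.
Admissible : Letter → List Letter → Set
Admissible y [] = ⊤
Admissible y (L ∷ w) = Admissible L w
Admissible y (S ∷ w) = y ≡ L × Admissible S w
Admissible y (M ∷ w) = y ≡ S × Admissible M w

φ-last : Letter → Letter
φ-last L = S
φ-last S = M
φ-last M = S

module Spacing (k : ℕ) where

  open Iterates (suc k) using (p; u-at-iter)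

  q : ℕ
  q = p * p + p

  Admissible-replicateL-S : ∀ j y r → Admissible S r → Admissible y (replicate (suc j) L ++ S ∷ r)
  Admissible-replicateL-S zero y r ad = refl , ad
  Admissible-replicateL-S (suc j) y r ad = Admissible-replicateL-S j L r ad

  Admissible-φ* : ∀ w y → Admissible y w → Admissible (φ-last y) (φ* p w)
  Admissible-φ* [] y _ = tt
  Admissible-φ* (L ∷ w) y ad =
    subst (Admissible S) (sym (++-assoc (replicate p L) (S ∷ []) (φ* p w)))
      (Admissible-replicateL-S (suc k) S _ (Admissible-φ* w L ad))
  Admissible-φ* (S ∷ w) y (refl , ad) = refl , Admissible-φ* w S ad
  Admissible-φ* (M ∷ w) y (_ , ad) =
    subst (Admissible (φ-last y)) (sym (++-assoc (replicate (suc k) L) (S ∷ []) (φ* p w)))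
      (Admissible-replicateL-S k (φ-last y) (φ* p w) (Admissible-φ* w M ad))

  Admissible-iter : ∀ m → ∃ λ y → Admissible y (iter p m)
  Admissible-iter zero = L , tt
  Admissible-iter (suc m) with Admissible-iter m
  ... | y , ad = φ-last y , Admissible-φ* (iter p m) y ad

  φ*-replicateL-S : ∀ j w → φ* p ((replicate j L ++ S ∷ []) ++ w) ≡ φ* p (replicate j L ++ S ∷ w)
  φ*-replicateL-S j w = cong (φ* p) (++-assoc (replicate j L) (S ∷ []) w)

  Spaced-φ*-replicateL : ∀ j {d} r → Spaced q (j * suc p + d) (φ* p r) →
                         Spaced q d (φ* p (replicate j L ++ r))
  Spaced-φ*-replicateL zero r sp = sp
  Spaced-φ*-replicateL (suc j) {d} r sp =
    subst (Spaced q d) (sym (++-assoc (replicate p L) (S ∷ []) (φ* p (replicate j L ++ r))))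
      (Spaced-replicateL p _
        (Spaced-φ*-replicateL j r (subst (λ e → Spaced q e (φ* p r)) regroup sp)))
    where
    regroup : suc p + j * suc p + d ≡ j * suc p + suc (p + d)
    regroup = trans (cong (_+ d) (+-comm (suc p) (j * suc p))) (+-assoc (j * suc p) (suc p) d)

  q≤φ²L : ∀ d → q ≤ suc (p * suc p + d)
  q≤φ²L d = ≤-trans (≤-reflexive (trans (+-comm (p * p) p) (sym (*-suc p p))))
              (≤-trans (m≤m+n (p * suc p) d) (n≤1+n _))

  -- The M ending φ²(M) follows the (p - 1)(p + 1) other letters of φ²(M) and the d ≥ p
  -- letters before it.
  q≤φ²M : ∀ d → p ≤ d → q ≤ suc (suc k * suc p + d)
  q≤φ²M d p≤d = ≤-trans (≤-reflexive q≡) (s≤s (+-monoʳ-≤ (suc k * suc p) p≤d))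
    where
    open +-*-Solver
    q≡ : q ≡ suc (suc k * suc p + p)
    q≡ = solve 1 (λ k → (con 2 :+ k) :* (con 2 :+ k) :+ (con 2 :+ k)
                   := con 1 :+ ((con 1 :+ k) :* (con 3 :+ k) :+ (con 2 :+ k))) refl k

  Spaced-φ² : ∀ w y {d} → Admissible y w → (y ≡ S → p ≤ d) → Spaced q d (φ* p (φ* p w))
  Spaced-φ² [] y _ _ = tt
  Spaced-φ² (L ∷ w) y {d} ad _ =
    subst (Spaced q d) (sym (φ*-replicateL-S p (φ* p w)))
      (Spaced-φ*-replicateL p (S ∷ φ* p w) (q≤φ²L d , Spaced-φ² w L ad (λ ())))
  Spaced-φ² (S ∷ w) y {d} (_ , ad) _ =
    subst (Spaced q d) (sym (++-assoc (replicate (suc k) L) (S ∷ []) (φ* p (φ* p w))))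
      (Spaced-replicateL (suc k) _ (Spaced-φ² w S ad (λ _ → s≤s (s≤s (m≤m+n k d)))))
  Spaced-φ² (M ∷ w) y {d} (y≡S , ad) y≡S⇒p≤d =
    subst (Spaced q d) (sym (φ*-replicateL-S (suc k) (φ* p w)))
      (Spaced-φ*-replicateL (suc k) (S ∷ φ* p w)
        (q≤φ²M d (y≡S⇒p≤d y≡S) , Spaced-φ² w M ad (λ ())))

  Spaced-iter : ∀ m → Spaced q q (iter p m)
  Spaced-iter zero = tt
  Spaced-iter (suc zero) = subst (Spaced q q) (sym (++-identityʳ (replicate p L ++ S ∷ [])))
                             (Spaced-replicateL p (S ∷ []) tt)
  Spaced-iter (suc (suc m)) with Admissible-iter m
  ... | y , ad = Spaced-φ² (iter p m) y ad (λ _ → m≤n+m p (p * p))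

  u-spaced : SpacedBy q (u p)
  u-spaced {a} {b} ua≡M ub≡M a<b =
    Spaced-gap (iter p (suc b)) a b (Spaced-iter (suc b))
      (trans (sym (u-at-iter (≤-trans a<b (n≤1+n b)))) ua≡M)
      (trans (sym (u-at-iter {b} ≤-refl)) ub≡M) a<b

module WindowCounts (p g : ℕ) (spaced : SpacedBy (suc g) (u p)) where

  -- No M among the g ∸ j positions starting at i.
  ClearAhead : ℕ → ℕ → Set
  ClearAhead i j = ∀ t → u p (i + t) ≡ M → g ≤ t + j

  countM-factor-clear : ∀ n i j → ClearAhead i j → suc g * countM (factor p i n) ≤ n + j
  countM-factor-clear zero i j _ = ≤-trans (≤-reflexive (*-zeroʳ g)) z≤n
  countM-factor-clear (suc n) i j clear with isM (u p i)
  ... | no _ =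
    ≤-trans (countM-factor-clear n (suc i) (suc j) clear′) (≤-reflexive (+-suc n j))
    where
    clear′ : ClearAhead (suc i) (suc j)
    clear′ t ut≡M =
      subst (g ≤_) (sym (+-suc t j)) (clear (suc t) (trans (cong (u p) (+-suc i t)) ut≡M))
  ... | yes ui≡M = begin
      suc g * suc (countM rest) ≡⟨ *-suc (suc g) _ ⟩
      suc g + suc g * countM rest ≤⟨ +-mono-≤ (s≤s g≤j) (countM-factor-clear n (suc i) 0 clear′) ⟩
      suc j + (n + 0)             ≡⟨ cong (λ m → suc (j + m)) (+-identityʳ n) ⟩
      suc (j + n)                 ≡⟨ cong suc (+-comm j n) ⟩
      suc n + j                   ∎
    where
    open ≤-Reasoning
    rest : List Letter
    rest = factor p (suc i) n
    g≤j : g ≤ j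
    g≤j = clear 0 (trans (cong (u p) (+-identityʳ i)) ui≡M)
    clear′ : ClearAhead (suc i) 0
    clear′ t ut≡M =
      ≤-trans (+-cancelˡ-≤ i g t (≤-pred (subst (_≤ suc (i + t)) (+-suc i g) gap))) (m≤m+n t 0)
      where
      gap : i + suc g ≤ suc i + t
      gap = spaced ui≡M ut≡M (s≤s (m≤m+n i t))

  countM-factor-≤ : ∀ i n → suc g * countM (factor p i n) ≤ n + g
  countM-factor-≤ i n = countM-factor-clear n i g (λ t _ → m≤n+m g t)

  countM-factor-+1≤ : ∀ i n → suc g * countM (factor p i n) + 1 ≤ suc g + n
  countM-factor-+1≤ i n = begin
    suc g * countM (factor p i n) + 1 ≡⟨ +-comm _ 1 ⟩
    suc (suc g * countM (factor p i n)) ≤⟨ s≤s (countM-factor-≤ i n) ⟩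
    suc (n + g)                       ≡⟨ cong suc (+-comm n g) ⟩
    suc g + n                         ∎
    where open ≤-Reasoning

  countM-factor-≤-⌈/⌉ : ∀ i n → countM (factor p i n) ≤ ⌈ n / suc g ⌉
  countM-factor-≤-⌈/⌉ i n = begin
    countM (factor p i n)                 ≡⟨ sym (m*n/n≡m _ (suc g)) ⟩
    countM (factor p i n) * suc g / suc g ≤⟨ /-monoˡ-≤ (suc g) c*q≤n+g ⟩
    (n + g) / suc g                       ∎
    where
    open ≤-Reasoning
    c*q≤n+g : countM (factor p i n) * suc g ≤ n + g
    c*q≤n+g = ≤-trans (≤-reflexive (*-comm _ (suc g))) (countM-factor-≤ i n)

  countM-factor-M-free-end : ∀ i n Δ →
    countM (take Δ (factor p i n)) ≡ 0 ⊎ countM (drop (n ∸ Δ) (factor p i n)) ≡ 0 →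
    countM (factor p i n) ≤ ⌈ (n ∸ Δ) / suc g ⌉
  countM-factor-M-free-end i n Δ (inj₁ prefix) = begin
    countM v                              ≡⟨ countM-take-drop Δ v ⟩
    countM (take Δ v) + countM (drop Δ v) ≡⟨ cong₂ _+_ prefix (cong countM (drop-factor p i Δ n)) ⟩
    countM (factor p (i + Δ) (n ∸ Δ))     ≤⟨ countM-factor-≤-⌈/⌉ (i + Δ) (n ∸ Δ) ⟩
    ⌈ (n ∸ Δ) / suc g ⌉                   ∎
    where
    open ≤-Reasoning
    v : List Letter
    v = factor p i n
  countM-factor-M-free-end i n Δ (inj₂ suffix) = begin
    countM v                                          ≡⟨ countM-take-drop (n ∸ Δ) v ⟩
    countM (take (n ∸ Δ) v) + countM (drop (n ∸ Δ) v) ≡⟨ cong₂ _+_ (cong countM prefix≡) suffix ⟩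
    countM (factor p i (n ∸ Δ)) + 0                   ≡⟨ +-identityʳ _ ⟩
    countM (factor p i (n ∸ Δ))                       ≤⟨ countM-factor-≤-⌈/⌉ i (n ∸ Δ) ⟩
    ⌈ (n ∸ Δ) / suc g ⌉                               ∎
    where
    open ≤-Reasoning
    v : List Letter
    v = factor p i n
    prefix≡ : take (n ∸ Δ) v ≡ factor p i (n ∸ Δ)
    prefix≡ = take-factor p i (m∸n≤m n Δ)

mainTheorem10 : (p : ℕ) → 1 < p →
    ((i n : ℕ) →
    (p * p + p) * countM (factor p i n) + 1 ≤ (p * p + p) + n)
    ×
    ((i n Δ : ℕ) → Δ ≤ n →
    (countM (take Δ (factor p i n)) ≡ 0 ⊎ countM (drop (n ∸ Δ) (factor p i n)) ≡ 0) →
    countM (factor p i n) ≤ ⌈ (n ∸ Δ) / (p * p + p) ⌉)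
mainTheorem10 (suc (suc k)) _ = countM-factor-+1≤ , λ i n Δ _ → countM-factor-M-free-end i n Δ
  -- p * p + p reduces to suc (p * p + p ∸ 1).
  where open WindowCounts (suc (suc k)) (Spacing.q k ∸ 1) (Spacing.u-spaced k)
mainTheorem10 (suc zero) (s≤s ())
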